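{- Let $L$ be either $\mathbf{IL}^-(\mathbf{J2}_+,\mathbf{J5})$ or $\mathbf{IL}=\mathbf{IL}^-(\mathbf{J1},\mathbf{J2},\mathbf{J5})$. Then for every formula $A$ the following are equivalent: (1) $L\vdash A$; (2) $A$ is valid in every $\mathbf{IL}^-$-frame in which all axioms of $L$ are valid; (3) $A$ is valid in every finite $\mathbf{IL}^-$-frame in which all axioms of $L$ are valid.
   Context: Formulas are built from countably many propositional variables, $\top,\bot$, the connectives $\neg,\land,\lor,\to$, a unary modal operator $\Box$ and a binary modal operator $\rhd$; $\Diamond A$ abbreviates $\neg\Box\neg A$. The logic $\mathbf{IL}^-$ has as axioms all tautologies, $\Box(A\to B)\to(\Box A\to\Box B)$, $\Box(\Box A\to A)\to\Box A$, $\mathbf{J3}$: $(A\rhd C)\land(B\rhd C)\to(A\lor B)\rhd C$, and $\mathbf{J6}$: $\Box A\leftrightarrow(\neg A)\rhd\bot$; its rules are modus ponens, necessitation, $\mathbf{R1}$ (from $A\to B$ infer $C\rhd A\to C\rhd B$) and $\mathbf{R2}$ (from $A\to B$ infer $B\rhd C\to A\rhd C$). $\mathbf{IL}^-(\Sigma_1,\dots,\Sigma_n)$ denotes $\mathbf{IL}^-$ with the schemata $\Sigma_i$ added as axioms. Schemata: $\mathbf{J1}$: $\Box(A\to B)\to A\rhd B$; $\mathbf{J2}$: $(A\rhd B)\land(B\rhd C)\to A\rhd C$; $\mathbf{J2}_+$: $(A\rhd(B\lor C))\land(B\rhd C)\to A\rhd C$; $\mathbf{J5}$: $\Diamond A\rhd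 A$. An $\mathbf{IL}^-$-frame is a triple $\langle W,R,\{S_x\}_{x\in W}\rangle$ with $W$ nonempty, $R$ transitive and conversely well-founded on $W$, and each $S_x$ a binary relation on $W$ with $yS_xz\Rightarrow xRy$. Satisfaction: Boolean clauses as usual, $x\Vdash\Box A$ iff $y\Vdash A$ for all $y$ with $xRy$, and $x\Vdash A\rhd B$ iff for every $y$ with $xRy$ and $y\Vdash A$ there is $z$ with $yS_xz$ and $z\Vdash B$. A formula is valid in a frame if it holds at every point under every satisfaction relation; a schema is valid if all instances are. -}

module Defs where

open import Data.Nat using (ℕ)
open import Data.Bool using (Bool; true; false; not; _∧_; _∨_)
open import Data.Fin using (Fin)
open import Data.Product using (Σ; _×_; _,_)
open import Data.Sum using (_⊎_)
open import Data.Unit using (⊤)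
open import Data.Empty using (⊥)
open import Relation.Nullary using (¬_)
open import Relation.Binary.PropositionalEquality using (_≡_)
open import Induction.WellFounded using (WellFounded)
open import Function.Bundles using (_↔_)
open import Level using (0ℓ)

infixr 6 _⋀_
infixr 5 _⋁_
infixr 4 _⇒_
infix  7 _▷_
infix  3 _⇔'_
infix  8 ¬'_ □_ ◇_

data Fm : Set where
  var  : ℕ → Fm
  ⊤'   : Fm
  ⊥'   : Fm
  ¬'_  : Fm → Fm
  _⋀_  : Fm → Fm → Fm
  _⋁_  : Fm → Fm → Fm
  _⇒_  : Fm → Fm → Fm
  □_   : Fm → Fm
  _▷_  : Fm → Fm → Fm

◇_ : Fm → Fm
◇ A = ¬' (□ (¬' A))

_⇔'_ : Fm → Fm → Fm
A ⇔' B = (A ⇒ B) ⋀ (B ⇒ A)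

-- Tautologies: propositional tautologies of the modal language, where
-- variables and modalised formulas (□A, A ▷ B) are treated as atoms.

evalB : (Fm → Bool) → Fm → Bool
evalB v (var p) = v (var p)
evalB v ⊤' = true
evalB v ⊥' = false
evalB v (¬' A) = not (evalB v A)
evalB v (A ⋀ B) = evalB v A ∧ evalB v B
evalB v (A ⋁ B) = evalB v A ∨ evalB v B
evalB v (A ⇒ B) = not (evalB v A) ∨ evalB v B
evalB v (□ A) = v (□ A)
evalB v (A ▷ B) = v (A ▷ B)

Tautology : Fm → Set
Tautology A = (v : Fm → Bool) → evalB v A ≡ true

data BaseAxiom : Fm → Set where
  taut : ∀ {A} → Tautology A → BaseAxiom A
  axK  : ∀ A B → BaseAxiom (□ (A ⇒ B) ⇒ (□ A ⇒ □ B))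
  axL  : ∀ A → BaseAxiom (□ (□ A ⇒ A) ⇒ □ A)
  axJ3 : ∀ A B C → BaseAxiom (((A ▷ C) ⋀ (B ▷ C)) ⇒ ((A ⋁ B) ▷ C))
  axJ6 : ∀ A → BaseAxiom (□ A ⇔' ((¬' A) ▷ ⊥'))

data J1 : Fm → Set where
  inst : ∀ A B → J1 (□ (A ⇒ B) ⇒ (A ▷ B))

data J2 : Fm → Set where
  inst : ∀ A B C → J2 (((A ▷ B) ⋀ (B ▷ C)) ⇒ (A ▷ C))

data J2+ : Fm → Set where
  inst : ∀ A B C → J2+ (((A ▷ (B ⋁ C)) ⋀ (B ▷ C)) ⇒ (A ▷ C))

data J5 : Fm → Set where
  inst : ∀ A → J5 ((◇ A) ▷ A)

data _⊢_ (Extra : Fm → Set) : Fm → Set where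
  base : ∀ {A} → BaseAxiom A → Extra ⊢ A
  extra : ∀ {A} → Extra A → Extra ⊢ A
  mp   : ∀ {A B} → Extra ⊢ (A ⇒ B) → Extra ⊢ A → Extra ⊢ B
  nec  : ∀ {A} → Extra ⊢ A → Extra ⊢ (□ A)
  R1   : ∀ {A B} C → Extra ⊢ (A ⇒ B) → Extra ⊢ ((C ▷ A) ⇒ (C ▷ B))
  R2   : ∀ {A B} C → Extra ⊢ (A ⇒ B) → Extra ⊢ ((B ▷ C) ⇒ (A ▷ C))

data WhichL : Set where
  IL⁻J2+J5 : WhichL
  IL       : WhichL

ExtraAx : WhichL → Fm → Set
ExtraAx IL⁻J2+J5 A = J2+ A ⊎ J5 A
ExtraAx IL A = J1 A ⊎ (J2 A ⊎ J5 A)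

AxiomOf : WhichL → Fm → Set
AxiomOf L A = BaseAxiom A ⊎ ExtraAx L A

record Frame : Set₁ where
  field
    W     : Set
    inhabited : W
    R     : W → W → Set
    S     : W → W → W → Set          -- S x y z  means  y S_x z
    R-trans : ∀ {x y z} → R x y → R y z → R x z
    R-cwf : WellFounded (λ y x → R x y)
    S⊆R   : ∀ {x y z} → S x y z → R x y

open Frame public

Valuation : Frame → Set₁
Valuation F = W F → ℕ → Set

Forces : (F : Frame) → Valuation F → W F → Fm → Set
Forces F V x (var p) = V x p
Forces F V x ⊤' = ⊤
Forces F V x ⊥' = ⊥
Forces F V x (¬' A) = ¬ Forces F V x A
Forces F V x (A ⋀ B) = Forces F V x A × Forces F V x B
Forces F V x (A ⋁ B) = Forces F V x A ⊎ Forces F V x B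
Forces F V x (A ⇒ B) = Forces F V x A → Forces F V x B
Forces F V x (□ A) = ∀ y → R F x y → Forces F V y A
Forces F V x (A ▷ B) =
  ∀ y → R F x y → Forces F V y A → Σ (W F) (λ z → S F x y z × Forces F V z B)

ValidIn : Frame → Fm → Set₁
ValidIn F A = (V : Valuation F) (x : W F) → Forces F V x A

LFrame : WhichL → Frame → Set₁
LFrame L F = ∀ A → AxiomOf L A → ValidIn F A

FiniteFrame : Frame → Set
FiniteFrame F = Σ ℕ (λ n → W F ↔ Fin n)

ValidAllL : WhichL → Fm → Set₁
ValidAllL L A = (F : Frame) → LFrame L F → ValidIn F A

ValidFinL : WhichL → Fm → Set₁
ValidFinL L A = (F : Frame) → FiniteFrame F → LFrame L F → ValidIn F A

module Submission where

-- Soundness is by induction on derivations: the axioms of IL⁻ are valid in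
-- every frame, and each extra schema is valid in frames satisfying a matching
-- frame condition.  Restricting from all to finite frames is immediate, so the
-- substance is completeness for finite frames, proved with excluded middle by
-- a finite canonical countermodel for an unprovable A₀.  Contexts are maximal
-- consistent conjunctions of literals over a finite adequate set Φ ⊇ Sub(A₀).
-- A world is a sequence of contexts, each carrying a label C (⊥ or a consequent
-- of a ▷-subformula) and being C-critical over its predecessor; R is proper
-- extension, and τ S_σ ρ says that τ, ρ extend σ with the same new label C and
-- ρ refutes C.  Along R the set of □-formulas proved strictly grows, which
-- bounds the length of worlds, giving finiteness and converse well-foundedness.
-- The consistency of critical successors (via Löb, J2₊ and J5) yields the
-- existence lemmas, hence the truth lemma and the countermodel.

open import Defs
open import Level using (0ℓ)
open import Axiom.ExcludedMiddle using (ExcludedMiddle)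
open import Axiom.DoubleNegationElimination using (em⇒dne)
open import Data.Nat using (ℕ; zero; suc; _*_; _≤_; _<_; z≤n; s≤s; pred; _∸_; _^_)
open import Data.Nat.Properties
  using (≤-refl; ≤-trans; <-trans; ≤-<-trans; <-≤-trans; n<1+n; m≤n⇒m≤1+n; m≤n⇒m<n∨m≡n;
         m<1+n⇒m<n∨m≡n; <⇒≤pred; pred[n]≤n; ∸-monoʳ-<; ≤-pred)
open import Data.Nat.Induction using (<-wellFounded)
open import Data.Bool using (Bool; true; false; not; _∧_; _∨_)
open import Data.Bool.Properties using (∧-conicalˡ; ∧-conicalʳ)
open import Data.Fin using (Fin; toℕ; fromℕ<) renaming (zero to fzero; suc to fsuc)
open import Data.Fin.Properties using (toℕ<n; toℕ-fromℕ<; 2↔Bool; *↔×)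
open import Data.Vec using (Vec; []; _∷_; replicate)
import Data.Vec as Vec
open import Data.Vec.Properties using (lookup-map)
open import Data.List using (List; []; _∷_; _++_; map; length; lookup; concatMap; filter)
open import Data.List.Properties using (length-filter)
open import Data.List.Membership.Propositional using (_∈_; find; lose)
open import Data.List.Membership.Propositional.Properties
  using (∈-map⁺; ∈-++⁺ˡ; ∈-++⁺ʳ; ∈-++⁻; ∈-concatMap⁺; ∈-concatMap⁻; ∈-filter⁺; ∈-filter⁻; ∈-lookup)
open import Data.List.Relation.Unary.Any using (here; there)
import Data.List.Relation.Unary.Any as Any
open import Data.List.Relation.Unary.Any.Properties using (lookup-index)
open import Data.List.Relation.Binary.Subset.Propositional using (_⊆_)
open import Data.Product using (Σ; _×_; _,_; proj₁; proj₂)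
open import Data.Product.Function.NonDependent.Propositional using (_×-↔_)
open import Data.Sum using (_⊎_; inj₁; inj₂)
open import Data.Unit using (tt)
open import Data.Empty using (⊥; ⊥-elim)
open import Function using (_∘_; id)
open import Function.Bundles using (_⇔_; mk⇔; _↔_; mk↔ₛ′)
open import Function.Properties.Inverse using (↔-refl; ↔-sym; ↔-trans)
open import Induction.WellFounded using (Acc; acc; module Subrelation)
import Relation.Binary.Construct.On as On
open import Relation.Unary using (Decidable)
open import Relation.Nullary using (¬_; Dec; yes; no; does; ¬?)
open import Relation.Nullary.Decidable using (_×-dec_; _⊎-dec_; _→-dec_)
open import Relation.Binary.PropositionalEquality using (_≡_; refl; sym; trans; cong; cong₂; subst; subst₂)

-- A template is a propositional formula over the metavariables #0, #1, … .
-- If every row of its truth table is true, then every instance obtained by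
-- substituting modal formulas for the metavariables is a tautology; this
-- discharges all purely propositional steps of the development.

infixr 6 _∧ₜ_
infixr 5 _∨ₜ_
infixr 4 _⇒ₜ_

data Template (n : ℕ) : Set where
  mvar : Fin n → Template n
  ⊤ₜ ⊥ₜ : Template n
  ¬ₜ_ : Template n → Template n
  _∧ₜ_ _∨ₜ_ _⇒ₜ_ : Template n → Template n → Template n

#0 : ∀ {n} → Template (suc n)
#0 = mvar fzero
#1 : ∀ {n} → Template (suc (suc n))
#1 = mvar (fsuc fzero)
#2 : ∀ {n} → Template (suc (suc (suc n)))
#2 = mvar (fsuc (fsuc fzero))
#3 : ∀ {n} → Template (suc (suc (suc (suc n))))
#3 = mvar (fsuc (fsuc (fsuc fzero)))
#4 : ∀ {n} → Template (suc (suc (suc (suc (suc n)))))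
#4 = mvar (fsuc (fsuc (fsuc (fsuc fzero))))

instantiate : ∀ {n} → Vec Fm n → Template n → Fm
instantiate σ (mvar i) = Vec.lookup σ i
instantiate σ ⊤ₜ = ⊤'
instantiate σ ⊥ₜ = ⊥'
instantiate σ (¬ₜ p) = ¬' instantiate σ p
instantiate σ (p ∧ₜ q) = instantiate σ p ⋀ instantiate σ q
instantiate σ (p ∨ₜ q) = instantiate σ p ⋁ instantiate σ q
instantiate σ (p ⇒ₜ q) = instantiate σ p ⇒ instantiate σ q

row : ∀ {n} → Vec Bool n → Template n → Bool
row ρ (mvar i) = Vec.lookup ρ i
row ρ ⊤ₜ = true
row ρ ⊥ₜ = false
row ρ (¬ₜ p) = not (row ρ p)
row ρ (p ∧ₜ q) = row ρ p ∧ row ρ q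
row ρ (p ∨ₜ q) = row ρ p ∨ row ρ q
row ρ (p ⇒ₜ q) = not (row ρ p) ∨ row ρ q

everyRow : ∀ n → (Vec Bool n → Bool) → Bool
everyRow zero f = f []
everyRow (suc n) f = everyRow n (λ ρ → f (true ∷ ρ)) ∧ everyRow n (λ ρ → f (false ∷ ρ))

everyRow-sound : ∀ n f → everyRow n f ≡ true → ∀ ρ → f ρ ≡ true
everyRow-sound zero f h [] = h
everyRow-sound (suc n) f h (true ∷ ρ) = everyRow-sound n _ (∧-conicalˡ _ _ h) ρ
everyRow-sound (suc n) f h (false ∷ ρ) = everyRow-sound n _ (∧-conicalʳ _ _ h) ρ

evalB-instantiate : ∀ {n} v (σ : Vec Fm n) p →
                    evalB v (instantiate σ p) ≡ row (Vec.map (evalB v) σ) p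
evalB-instantiate v σ (mvar i) = sym (lookup-map i (evalB v) σ)
evalB-instantiate v σ ⊤ₜ = refl
evalB-instantiate v σ ⊥ₜ = refl
evalB-instantiate v σ (¬ₜ p) = cong not (evalB-instantiate v σ p)
evalB-instantiate v σ (p ∧ₜ q) = cong₂ _∧_ (evalB-instantiate v σ p) (evalB-instantiate v σ q)
evalB-instantiate v σ (p ∨ₜ q) = cong₂ _∨_ (evalB-instantiate v σ p) (evalB-instantiate v σ q)
evalB-instantiate v σ (p ⇒ₜ q) =
  cong₂ (λ a b → not a ∨ b) (evalB-instantiate v σ p) (evalB-instantiate v σ q)

tautology-instance : ∀ {n} (p : Template n) (σ : Vec Fm n) →
                     everyRow n (λ ρ → row ρ p) ≡ true → Tautology (instantiate σ p)
tautology-instance {n} p σ h v =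
  trans (evalB-instantiate v σ p) (everyRow-sound n (λ ρ → row ρ p) h (Vec.map (evalB v) σ))

module Basic (L : WhichL) where

  infix 1 ⊢ₗ_
  ⊢ₗ_ : Fm → Set
  ⊢ₗ A = ExtraAx L ⊢ A

  infixl 2 _·_
  _·_ : ∀ {A B} → ⊢ₗ (A ⇒ B) → ⊢ₗ A → ⊢ₗ B
  _·_ = mp

  by-table : ∀ {n} (p : Template n) σ → everyRow n (λ ρ → row ρ p) ≡ true → ⊢ₗ instantiate σ p
  by-table p σ h = base (taut (tautology-instance p σ h))

  ⇒-trans : ∀ {X Y Z} → ⊢ₗ X ⇒ Y → ⊢ₗ Y ⇒ Z → ⊢ₗ X ⇒ Z
  ⇒-trans {X} {Y} {Z} p q = by-table ((#0 ⇒ₜ #1) ⇒ₜ (#1 ⇒ₜ #2) ⇒ₜ (#0 ⇒ₜ #2)) (X ∷ Y ∷ Z ∷ []) refl · p · q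

  contraposition : ∀ {X Y} → ⊢ₗ X ⇒ Y → ⊢ₗ ¬' Y ⇒ ¬' X
  contraposition {X} {Y} p = by-table ((#0 ⇒ₜ #1) ⇒ₜ (¬ₜ #1 ⇒ₜ ¬ₜ #0)) (X ∷ Y ∷ []) refl · p

  □-mono : ∀ {X Y} → ⊢ₗ X ⇒ Y → ⊢ₗ □ X ⇒ □ Y
  □-mono p = base (axK _ _) · nec p

  ⇒-refl : ∀ {X} → ⊢ₗ X ⇒ X
  ⇒-refl {X} = by-table (#0 ⇒ₜ #0) (X ∷ []) refl

  ∧-elimˡ : ∀ {X Y} → ⊢ₗ (X ⋀ Y) ⇒ X
  ∧-elimˡ {X} {Y} = by-table (#0 ∧ₜ #1 ⇒ₜ #0) (X ∷ Y ∷ []) refl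

  ∧-elimʳ : ∀ {X Y} → ⊢ₗ (X ⋀ Y) ⇒ Y
  ∧-elimʳ {X} {Y} = by-table (#0 ∧ₜ #1 ⇒ₜ #1) (X ∷ Y ∷ []) refl

  ∧-intro : ∀ {X Y} → ⊢ₗ X ⇒ (Y ⇒ (X ⋀ Y))
  ∧-intro {X} {Y} = by-table (#0 ⇒ₜ #1 ⇒ₜ #0 ∧ₜ #1) (X ∷ Y ∷ []) refl

  □⇒▷⊥ : ∀ X → ⊢ₗ □ X ⇒ ((¬' X) ▷ ⊥')
  □⇒▷⊥ X = ∧-elimˡ · base (axJ6 X)

  ▷⊥⇒□ : ∀ X → ⊢ₗ ((¬' X) ▷ ⊥') ⇒ □ X
  ▷⊥⇒□ X = ∧-elimʳ · base (axJ6 X)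

  -- Löb's axiom in the form used for critical successors: if A together with
  -- □¬A proves R, then A proves R or ◇R (semantically: pass to an R-last A-world).
  löb-maximal : ∀ {A R} → ⊢ₗ (A ⋀ □ (¬' A)) ⇒ R → ⊢ₗ A ⇒ (R ⋁ ◇ R)
  löb-maximal {A} {R} h =
    by-table ((#0 ∧ₜ #1 ⇒ₜ #2) ⇒ₜ (#3 ⇒ₜ #1) ⇒ₜ (#0 ⇒ₜ #2 ∨ₜ ¬ₜ #3))
             (A ∷ □ (¬' A) ∷ R ∷ □ (¬' R) ∷ []) refl · h · □¬R⇒□¬A
    where
      ¬R⇒□¬A⇒¬A : ⊢ₗ (¬' R) ⇒ (□ (¬' A) ⇒ ¬' A)
      ¬R⇒□¬A⇒¬A = by-table ((#0 ∧ₜ #1 ⇒ₜ #2) ⇒ₜ (¬ₜ #2 ⇒ₜ (#1 ⇒ₜ ¬ₜ #0)))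
                            (A ∷ □ (¬' A) ∷ R ∷ []) refl · h
      □¬R⇒□¬A : ⊢ₗ □ (¬' R) ⇒ □ (¬' A)
      □¬R⇒□¬A = ⇒-trans (□-mono ¬R⇒□¬A⇒¬A) (base (axL (¬' A)))

J5-derivable : ∀ L A → ExtraAx L ⊢ ((◇ A) ▷ A)
J5-derivable IL⁻J2+J5 A = extra (inj₂ (inst A))
J5-derivable IL A = extra (inj₂ (inj₂ (inst A)))

IL-▷-refl : ∀ C → ExtraAx IL ⊢ (C ▷ C)
IL-▷-refl C = extra (inj₁ (inst C C)) · nec ⇒-refl
  where open Basic IL

-- J2₊ is an axiom of IL⁻(J2₊,J5); in IL it follows from J2, J3 and C ▷ C:
-- A ▷ (B ∨ C) and (B ∨ C) ▷ C give A ▷ C.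
J2+-derivable : ∀ L A B C → ExtraAx L ⊢ (((A ▷ (B ⋁ C)) ⋀ (B ▷ C)) ⇒ (A ▷ C))
J2+-derivable IL⁻J2+J5 A B C = extra (inj₁ (inst A B C))
J2+-derivable IL A B C =
  by-table ((#1 ∧ₜ #2 ⇒ₜ #3) ⇒ₜ #2 ⇒ₜ (#0 ∧ₜ #3 ⇒ₜ #4) ⇒ₜ (#0 ∧ₜ #1 ⇒ₜ #4))
           ((A ▷ (B ⋁ C)) ∷ (B ▷ C) ∷ (C ▷ C) ∷ ((B ⋁ C) ▷ C) ∷ (A ▷ C) ∷ []) refl
    · base (axJ3 B C C) · IL-▷-refl C · extra (inj₂ (inj₁ (inst A (B ⋁ C) C)))
  where open Basic IL

-- Reasoning relative to a context formula c (the conjunction describing a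
-- world of the canonical model), with the rules J2₊ and J5 of L.
module Relative (L : WhichL) where
  open Basic L public

  infix 2 _⊩_
  _⊩_ : Fm → Fm → Set
  c ⊩ X = ⊢ₗ c ⇒ X

  Consistent : Fm → Set
  Consistent c = ¬ (c ⊩ ⊥')

  ⊩-thm : ∀ {c X} → ⊢ₗ X → c ⊩ X
  ⊩-thm {c} {X} p = by-table (#0 ⇒ₜ #1 ⇒ₜ #0) (X ∷ c ∷ []) refl · p

  ⊩-mp : ∀ {c X Y} → c ⊩ X ⇒ Y → c ⊩ X → c ⊩ Y
  ⊩-mp {c} {X} {Y} p q =
    by-table ((#0 ⇒ₜ #1 ⇒ₜ #2) ⇒ₜ (#0 ⇒ₜ #1) ⇒ₜ (#0 ⇒ₜ #2)) (c ∷ X ∷ Y ∷ []) refl · p · q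

  ⊩-⇒ : ∀ {c X Y} → ⊢ₗ X ⇒ Y → c ⊩ X → c ⊩ Y
  ⊩-⇒ p q = ⇒-trans q p

  ⊩-∧ : ∀ {c X Y} → c ⊩ X → c ⊩ Y → c ⊩ X ⋀ Y
  ⊩-∧ p q = ⊩-mp (⊩-⇒ ∧-intro p) q

  ⊩-R1 : ∀ {c A X Y} → ⊢ₗ X ⇒ Y → c ⊩ A ▷ X → c ⊩ A ▷ Y
  ⊩-R1 {A = A} p = ⊩-⇒ (R1 A p)

  ⊩-R2 : ∀ {c C X Y} → ⊢ₗ X ⇒ Y → c ⊩ Y ▷ C → c ⊩ X ▷ C
  ⊩-R2 {C = C} p = ⊩-⇒ (R2 C p)

  ⊩-J2+ : ∀ {c A B C} → c ⊩ A ▷ (B ⋁ C) → c ⊩ B ▷ C → c ⊩ A ▷ C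
  ⊩-J2+ p q = ⊩-⇒ (J2+-derivable L _ _ _) (⊩-∧ p q)

  ⊩-J3 : ∀ {c A B C} → c ⊩ A ▷ C → c ⊩ B ▷ C → c ⊩ (A ⋁ B) ▷ C
  ⊩-J3 p q = ⊩-⇒ (base (axJ3 _ _ _)) (⊩-∧ p q)

  ⊩-J2 : ∀ {c A B C} → c ⊩ A ▷ B → c ⊩ B ▷ C → c ⊩ A ▷ C
  ⊩-J2 {B = B} {C = C} p = ⊩-J2+ (⊩-R1 (by-table (#0 ⇒ₜ #0 ∨ₜ #1) (B ∷ C ∷ []) refl) p)

  ⊩-J5 : ∀ {c Y C} → c ⊩ Y ▷ C → c ⊩ (◇ Y) ▷ C
  ⊩-J5 = ⊩-J2 (⊩-thm (J5-derivable L _))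

  ⊩-□▷ : ∀ {c X C} → c ⊩ □ X → c ⊩ (¬' X) ▷ C
  ⊩-□▷ {C = C} p = ⊩-R1 (by-table (⊥ₜ ⇒ₜ #0) (C ∷ []) refl) (⊩-⇒ (□⇒▷⊥ _) p)

  ⊩-□¬▷ : ∀ {c A C} → c ⊩ □ (¬' A) → c ⊩ A ▷ C
  ⊩-□¬▷ {A = A} p = ⊩-R2 (by-table (#0 ⇒ₜ ¬ₜ ¬ₜ #0) (A ∷ []) refl) (⊩-□▷ p)

  ⊩-⊥▷ : ∀ {c C} → c ⊩ ⊥' ▷ C
  ⊩-⊥▷ = ⊩-R2 (by-table (⊥ₜ ⇒ₜ ¬ₜ ⊤ₜ) [] refl) (⊩-□▷ (⊩-thm (nec (by-table ⊤ₜ [] refl))))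

  inconsistent : ∀ {c X} → Consistent c → c ⊩ X → c ⊩ ¬' X → ⊥
  inconsistent {c} {X} cc p q =
    cc (by-table ((#0 ⇒ₜ #1) ⇒ₜ (#0 ⇒ₜ ¬ₜ #1) ⇒ₜ (#0 ⇒ₜ ⊥ₜ)) (c ∷ X ∷ []) refl · p · q)

  consistent-⇒ : ∀ {c d} → ⊢ₗ c ⇒ d → Consistent c → Consistent d
  consistent-⇒ p cc h = cc (⇒-trans p h)

  conj : List Fm → Fm
  conj [] = ⊤'
  conj (x ∷ xs) = x ⋀ conj xs

  negDisj : List Fm → Fm
  negDisj [] = ⊥'
  negDisj (x ∷ xs) = (¬' x) ⋁ negDisj xs

  ¬conj⇒negDisj : ∀ P → ⊢ₗ (¬' conj P) ⇒ negDisj P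
  ¬conj⇒negDisj [] = by-table (¬ₜ ⊤ₜ ⇒ₜ ⊥ₜ) [] refl
  ¬conj⇒negDisj (x ∷ P) =
    by-table ((¬ₜ #0 ⇒ₜ #1) ⇒ₜ (¬ₜ (#2 ∧ₜ #0) ⇒ₜ ¬ₜ #2 ∨ₜ #1)) (conj P ∷ negDisj P ∷ x ∷ []) refl
      · ¬conj⇒negDisj P

  conj-∈ : ∀ {u P} → u ∈ P → ⊢ₗ conj P ⇒ u
  conj-∈ (here refl) = ∧-elimˡ
  conj-∈ (there m) = ⇒-trans ∧-elimʳ (conj-∈ m)

  negDisj▷ : ∀ {c C} P → (∀ u → u ∈ P → c ⊩ (¬' u) ▷ C) → c ⊩ negDisj P ▷ C
  negDisj▷ [] h = ⊩-⊥▷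
  negDisj▷ (x ∷ P) h = ⊩-J3 (h x (here refl)) (negDisj▷ P (λ u m → h u (there m)))

  -- Consistency of the two kinds of C-critical successors of c.  In both, P
  -- lists formulas u with c ⊩ ¬u ▷ C (the obligations inherited from c).

  refuting-successor : ∀ {c A C W} P → (∀ u → u ∈ P → c ⊩ (¬' u) ▷ C) →
                       ⊢ₗ □ (¬' A) ⇒ □ W → ¬ (c ⊩ A ▷ C) → Consistent (conj (A ∷ □ W ∷ P))
  refuting-successor {c} {A} {C} {W} P hP □¬A⇒□W c⊮A▷C inc =
    c⊮A▷C (⊩-R2 (löb-maximal A∧□¬A⇒d) (⊩-J3 d▷C (⊩-J5 d▷C)))
    where
      d = negDisj P
      A∧□¬A⇒d : ⊢ₗ (A ⋀ □ (¬' A)) ⇒ d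
      A∧□¬A⇒d = by-table ((#0 ∧ₜ (#2 ∧ₜ #3) ⇒ₜ ⊥ₜ) ⇒ₜ (#1 ⇒ₜ #2) ⇒ₜ (¬ₜ #3 ⇒ₜ #4) ⇒ₜ (#0 ∧ₜ #1 ⇒ₜ #4))
                         (A ∷ □ (¬' A) ∷ □ W ∷ conj P ∷ d ∷ []) refl
                  · inc · □¬A⇒□W · ¬conj⇒negDisj P
      d▷C : c ⊩ d ▷ C
      d▷C = negDisj▷ P hP

  answering-successor : ∀ {c A B C} P → (∀ u → u ∈ P → c ⊩ (¬' u) ▷ C) →
                        c ⊩ A ▷ B → ¬ (c ⊩ A ▷ C) → Consistent (conj (B ∷ □ (¬' B) ∷ (¬' C) ∷ P))
  answering-successor {c} {A} {B} {C} P hP A▷B c⊮A▷C inc = c⊮A▷C (⊩-J2+ A▷rest∨C rest▷C)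
    where
      d = negDisj P
      B∧□¬B⇒C∨d : ⊢ₗ (B ⋀ □ (¬' B)) ⇒ (C ⋁ d)
      B∧□¬B⇒C∨d = by-table ((#0 ∧ₜ (#1 ∧ₜ (¬ₜ #2 ∧ₜ #3)) ⇒ₜ ⊥ₜ) ⇒ₜ (¬ₜ #3 ⇒ₜ #4) ⇒ₜ (#0 ∧ₜ #1 ⇒ₜ #2 ∨ₜ #4))
                           (B ∷ □ (¬' B) ∷ C ∷ conj P ∷ d ∷ []) refl
                  · inc · ¬conj⇒negDisj P
      A▷rest∨C : c ⊩ A ▷ ((d ⋁ ◇ (C ⋁ d)) ⋁ C)
      A▷rest∨C = ⊩-R1 (by-table ((#0 ∨ₜ #1) ∨ₜ #2 ⇒ₜ (#1 ∨ₜ #2) ∨ₜ #0) (C ∷ d ∷ ◇ (C ⋁ d) ∷ []) refl)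
                      (⊩-R1 (löb-maximal B∧□¬B⇒C∨d) A▷B)
      d▷C : c ⊩ d ▷ C
      d▷C = negDisj▷ P hP
      ◇C∨d▷C : c ⊩ ◇ (C ⋁ d) ▷ C
      ◇C∨d▷C = ⊩-J2+ (⊩-R1 (by-table (#0 ∨ₜ #1 ⇒ₜ #1 ∨ₜ #0) (C ∷ d ∷ []) refl)
                           (⊩-thm (J5-derivable L (C ⋁ d)))) d▷C
      rest▷C : c ⊩ (d ⋁ ◇ (C ⋁ d)) ▷ C
      rest▷C = ⊩-J3 d▷C ◇C∨d▷C

module _ (F : Frame) where
  J5Condition : Set
  J5Condition = ∀ {x y z} → R F x y → R F y z → S F x y z

  J2Condition : Set
  J2Condition = (∀ {x y w} → S F x y w → R F x w) × (∀ {x y w z} → S F x y w → S F x w z → S F x y z)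

  J1Condition : Set
  J1Condition = ∀ {x y} → R F x y → S F x y y

module Soundness (em : ExcludedMiddle 0ℓ) (F : Frame) where

  -- Classically forcing is decidable, and the decision of a Boolean
  -- combination is the truth-table value of the decisions of its atoms.
  forces? : ∀ V x A → Dec (Forces F V x A)
  forces? V x (var p) = em
  forces? V x ⊤' = yes tt
  forces? V x ⊥' = no (λ ())
  forces? V x (¬' A) = ¬? (forces? V x A)
  forces? V x (A ⋀ B) = forces? V x A ×-dec forces? V x B
  forces? V x (A ⋁ B) = forces? V x A ⊎-dec forces? V x B
  forces? V x (A ⇒ B) = forces? V x A →-dec forces? V x B
  forces? V x (□ A) = em
  forces? V x (A ▷ B) = em

  atomValue : Valuation F → W F → Fm → Bool
  atomValue V x A = does (forces? V x A)

  forces?-truth-table : ∀ V x A → does (forces? V x A) ≡ evalB (atomValue V x) A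
  forces?-truth-table V x (var p) = refl
  forces?-truth-table V x ⊤' = refl
  forces?-truth-table V x ⊥' = refl
  forces?-truth-table V x (¬' A) = cong not (forces?-truth-table V x A)
  forces?-truth-table V x (A ⋀ B) = cong₂ _∧_ (forces?-truth-table V x A) (forces?-truth-table V x B)
  forces?-truth-table V x (A ⋁ B) = cong₂ _∨_ (forces?-truth-table V x A) (forces?-truth-table V x B)
  forces?-truth-table V x (A ⇒ B) =
    cong₂ (λ a b → not a ∨ b) (forces?-truth-table V x A) (forces?-truth-table V x B)
  forces?-truth-table V x (□ A) = refl
  forces?-truth-table V x (A ▷ B) = refl

  accepted : ∀ {P : Set} (d : Dec P) → does d ≡ true → P
  accepted (yes p) _ = p

  tautology-valid : ∀ {A} → Tautology A → ValidIn F A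
  tautology-valid {A} t V x =
    accepted (forces? V x A) (trans (forces?-truth-table V x A) (t (atomValue V x)))

  -- The axioms of IL⁻ are valid in every frame; Löb's axiom by converse
  -- well-founded induction, J6 by double negation elimination.
  base-valid : ∀ {A} → BaseAxiom A → ValidIn F A
  base-valid (taut {A} t) = tautology-valid {A} t
  base-valid (axK A B) V x □A⇒B □A y xRy = □A⇒B y xRy (□A y xRy)
  base-valid (axL A) V x □[□A⇒A] y xRy = löb y (R-cwf F y) xRy
    where
      löb : ∀ y → Acc (λ a b → R F b a) y → R F x y → Forces F V y A
      löb y (acc rs) xRy = □[□A⇒A] y xRy (λ z yRz → löb z (rs yRz) (R-trans F xRy yRz))
  base-valid (axJ3 A B C) V x (A▷C , B▷C) y xRy (inj₁ a) = A▷C y xRy a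
  base-valid (axJ3 A B C) V x (A▷C , B▷C) y xRy (inj₂ b) = B▷C y xRy b
  base-valid (axJ6 A) V x =
    (λ □A y xRy ¬a → ⊥-elim (¬a (□A y xRy))) ,
    (λ ¬A▷⊥ y xRy → em⇒dne em (λ ¬a → proj₂ (proj₂ (¬A▷⊥ y xRy ¬a))))

  J5-valid : J5Condition F → ∀ {A} → J5 A → ValidIn F A
  J5-valid j5 (inst A) V x y xRy ◇a =
    em⇒dne em (λ none → ◇a (λ z yRz a → none (z , j5 xRy yRz , a)))

  J2+-valid : J2Condition F → ∀ {A} → J2+ A → ValidIn F A
  J2+-valid (S⊆R , S-trans) (inst A B C) V x (A▷B∨C , B▷C) y xRy a with A▷B∨C y xRy a
  ... | w , ySw , inj₂ c = w , ySw , c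
  ... | w , ySw , inj₁ b with B▷C w (S⊆R ySw) b
  ...   | z , wSz , c = z , S-trans ySw wSz , c

  J2-valid : J2Condition F → ∀ {A} → J2 A → ValidIn F A
  J2-valid (S⊆R , S-trans) (inst A B C) V x (A▷B , B▷C) y xRy a with A▷B y xRy a
  ... | w , ySw , b with B▷C w (S⊆R ySw) b
  ...   | z , wSz , c = z , S-trans ySw wSz , c

  J1-valid : J1Condition F → ∀ {A} → J1 A → ValidIn F A
  J1-valid j1 (inst A B) V x □A⇒B y xRy a = y , j1 xRy , □A⇒B y xRy a

  sound : ∀ L → LFrame L F → ∀ {A} → ExtraAx L ⊢ A → ValidIn F A
  sound L lf (base b) = lf _ (inj₁ b)
  sound L lf (extra e) = lf _ (inj₂ e)
  sound L lf (mp d e) V x = sound L lf d V x (sound L lf e V x)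
  sound L lf (nec d) V x y _ = sound L lf d V y
  sound L lf (R1 C d) V x C▷A y xRy c with C▷A y xRy c
  ... | z , ySz , a = z , ySz , sound L lf d V z a
  sound L lf (R2 C d) V x B▷C y xRy a = B▷C y xRy (sound L lf d V y a)

mutual
  Sub : Fm → List Fm
  Sub A = A ∷ properSub A

  properSub : Fm → List Fm
  properSub (¬' A) = Sub A
  properSub (A ⋀ B) = Sub A ++ Sub B
  properSub (A ⋁ B) = Sub A ++ Sub B
  properSub (A ⇒ B) = Sub A ++ Sub B
  properSub (□ A) = Sub A
  properSub (A ▷ B) = Sub A ++ Sub B
  properSub _ = []

module _ {A B : Set} {P : A → Set} (P? : Decidable P) (f : A → List B) where
  selected : List A → List B
  selected xs = concatMap f (filter P? xs)

  ∈-selected⁺ : ∀ {xs x u} → x ∈ xs → P x → u ∈ f x → u ∈ selected xs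
  ∈-selected⁺ x∈xs px u∈fx = ∈-concatMap⁺ f (lose (∈-filter⁺ P? x∈xs px) u∈fx)

  ∈-selected⁻ : ∀ {xs u} → u ∈ selected xs → Σ A (λ x → x ∈ xs × P x × u ∈ f x)
  ∈-selected⁻ {xs} u∈ with find (∈-concatMap⁻ f {filter P? xs} u∈)
  ... | x , x∈filter , u∈fx with ∈-filter⁻ P? x∈filter
  ...   | x∈xs , px = x , x∈xs , px , u∈fx

-- Reading and writing a vector at a natural-number position (with a default
-- value outside its range); worlds of the canonical model are such vectors.
at : ∀ {A : Set} {k} → A → Vec A k → ℕ → A
at d [] i = d
at d (x ∷ v) zero = x
at d (x ∷ v) (suc i) = at d v i

setAt : ∀ {A : Set} {k} → Vec A k → ℕ → A → Vec A k
setAt [] i e = []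
setAt (x ∷ v) zero e = e ∷ v
setAt (x ∷ v) (suc i) e = x ∷ setAt v i e

at-setAt-≡ : ∀ {A : Set} {k} (d : A) (v : Vec A k) i e → i < k → at d (setAt v i e) i ≡ e
at-setAt-≡ d (x ∷ v) zero e _ = refl
at-setAt-≡ d (x ∷ v) (suc i) e (s≤s i<k) = at-setAt-≡ d v i e i<k

at-setAt-< : ∀ {A : Set} {k} (d : A) (v : Vec A k) i j e → j < i → at d (setAt v i e) j ≡ at d v j
at-setAt-< d [] i j e j<i = refl
at-setAt-< d (x ∷ v) (suc i) zero e j<i = refl
at-setAt-< d (x ∷ v) (suc i) (suc j) e (s≤s j<i) = at-setAt-< d v i j e j<i

module _ {A : Set} {P Q : A → Set} (P? : Decidable P) (Q? : Decidable Q) where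
  filter-mono : ∀ xs → (∀ {x} → x ∈ xs → P x → Q x) → length (filter P? xs) ≤ length (filter Q? xs)
  filter-mono [] P⇒Q = ≤-refl
  filter-mono (x ∷ xs) P⇒Q with P? x | Q? x
  ... | yes _ | yes _ = s≤s (filter-mono xs (λ m → P⇒Q (there m)))
  ... | yes p | no ¬q = ⊥-elim (¬q (P⇒Q (here refl) p))
  ... | no _ | yes _ = m≤n⇒m≤1+n (filter-mono xs (λ m → P⇒Q (there m)))
  ... | no _ | no _ = filter-mono xs (λ m → P⇒Q (there m))

  filter-strict : ∀ xs → (∀ {x} → x ∈ xs → P x → Q x) →
                  ∀ {y} → y ∈ xs → Q y → ¬ P y → length (filter P? xs) < length (filter Q? xs)
  filter-strict (x ∷ xs) P⇒Q (here refl) qy ¬py with P? x | Q? x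
  ... | yes py | _ = ⊥-elim (¬py py)
  ... | no _ | yes _ = s≤s (filter-mono xs (λ m → P⇒Q (there m)))
  ... | no _ | no ¬qy = ⊥-elim (¬qy qy)
  filter-strict (x ∷ xs) P⇒Q (there y∈xs) qy ¬py with P? x | Q? x
  ... | yes _ | yes _ = s≤s (filter-strict xs (λ m → P⇒Q (there m)) y∈xs qy ¬py)
  ... | yes p | no ¬q = ⊥-elim (¬q (P⇒Q (here refl) p))
  ... | no _ | yes _ = m≤n⇒m≤1+n (filter-strict xs (λ m → P⇒Q (there m)) y∈xs qy ¬py)
  ... | no _ | no _ = filter-strict xs (λ m → P⇒Q (there m)) y∈xs qy ¬py

vec↔ : ∀ {A : Set} {a} → A ↔ Fin a → ∀ k → Vec A k ↔ Fin (a ^ k)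
vec↔ A↔ zero = mk↔ₛ′ (λ _ → fzero) (λ _ → []) (λ { fzero → refl ; (fsuc ()) }) (λ { [] → refl })
vec↔ {A} A↔ (suc k) = ↔-trans head-tail (↔-trans (A↔ ×-↔ vec↔ A↔ k) (↔-sym *↔×))
  where
    head-tail : Vec A (suc k) ↔ (A × Vec A k)
    head-tail = mk↔ₛ′ (λ { (x ∷ v) → x , v }) (λ { (x , v) → x ∷ v }) (λ _ → refl) (λ { (x ∷ v) → refl })

module SignedConjunctions (L : WhichL) (em : ExcludedMiddle 0ℓ) where
  open Relative L

  sign : Bool → Fm → Fm
  sign true x = x
  sign false x = ¬' x

  literals : (xs : List Fm) → Vec Bool (length xs) → List Fm
  literals [] [] = []
  literals (x ∷ xs) (a ∷ b) = sign a x ∷ literals xs b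

  signed : (xs : List Fm) → Vec Bool (length xs) → Fm
  signed xs b = conj (literals xs b)

  signed-decides : ∀ xs b {s} → s ∈ xs → (signed xs b ⊩ s) ⊎ (signed xs b ⊩ ¬' s)
  signed-decides (x ∷ xs) (true ∷ b) (here refl) = inj₁ ∧-elimˡ
  signed-decides (x ∷ xs) (false ∷ b) (here refl) = inj₂ ∧-elimˡ
  signed-decides (x ∷ xs) (_ ∷ b) (there s∈xs) with signed-decides xs b s∈xs
  ... | inj₁ p = inj₁ (⇒-trans ∧-elimʳ p)
  ... | inj₂ p = inj₂ (⇒-trans ∧-elimʳ p)

  some-sign-consistent : ∀ s t → Consistent t → Σ Bool (λ a → Consistent (sign a s ⋀ t))
  some-sign-consistent s t ct with em {(s ⋀ t) ⊩ ⊥'}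
  ... | no s∧t-consistent = true , s∧t-consistent
  ... | yes s∧t-inconsistent = false , ¬s∧t-consistent
    where
      ¬s∧t-consistent : Consistent ((¬' s) ⋀ t)
      ¬s∧t-consistent h = ct (by-table ((#0 ∧ₜ #1 ⇒ₜ ⊥ₜ) ⇒ₜ (¬ₜ #0 ∧ₜ #1 ⇒ₜ ⊥ₜ) ⇒ₜ (#1 ⇒ₜ ⊥ₜ))
                                       (s ∷ t ∷ []) refl · s∧t-inconsistent · h)

  lindenbaum : ∀ xs t → Consistent t → Σ (Vec Bool (length xs)) (λ b → Consistent (signed xs b ⋀ t))
  lindenbaum [] t ct = [] , consistent-⇒ (by-table (#0 ⇒ₜ ⊤ₜ ∧ₜ #0) (t ∷ []) refl) ct
  lindenbaum (s ∷ xs) t ct =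
    let a , cs = some-sign-consistent s t ct
        b , cb = lindenbaum xs (sign a s ⋀ t) cs
    in a ∷ b , consistent-⇒ (by-table (#0 ∧ₜ (#1 ∧ₜ #2) ⇒ₜ (#1 ∧ₜ #0) ∧ₜ #2)
                                       (signed xs b ∷ sign a s ∷ t ∷ []) refl) cb

  Literal : List Fm → Fm → Set
  Literal xs u = (u ∈ xs) ⊎ Σ Fm (λ s → (u ≡ ¬' s) × (s ∈ xs))

  signed-proves : ∀ xs b T {u} → Consistent (signed xs b ⋀ conj T) → u ∈ T → Literal xs u → signed xs b ⊩ u
  signed-proves xs b T {u} cons u∈T (inj₁ u∈xs) with signed-decides xs b u∈xs
  ... | inj₁ p = p
  ... | inj₂ p = ⊥-elim (cons (by-table ((#0 ⇒ₜ ¬ₜ #2) ⇒ₜ (#1 ⇒ₜ #2) ⇒ₜ (#0 ∧ₜ #1 ⇒ₜ ⊥ₜ))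
                                         (signed xs b ∷ conj T ∷ u ∷ []) refl · p · conj-∈ u∈T))
  signed-proves xs b T cons u∈T (inj₂ (s , refl , s∈xs)) with signed-decides xs b s∈xs
  ... | inj₂ p = p
  ... | inj₁ p = ⊥-elim (cons (by-table ((#0 ⇒ₜ #2) ⇒ₜ (#1 ⇒ₜ ¬ₜ #2) ⇒ₜ (#0 ∧ₜ #1 ⇒ₜ ⊥ₜ))
                                         (signed xs b ∷ conj T ∷ s ∷ []) refl · p · conj-∈ u∈T))

antecedents consequents boxBodies : Fm → List Fm
antecedents (A ▷ B) = A ∷ []
antecedents _ = []
consequents (A ▷ B) = B ∷ []
consequents _ = []
boxBodies (□ A) = A ∷ []
boxBodies _ = []

module Canonical (L : WhichL) (em : ExcludedMiddle 0ℓ) (A₀ : Fm) where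
  open Relative L
  open SignedConjunctions L em

  Labels Antecedents Boxed Φ : List Fm
  Labels = ⊥' ∷ concatMap consequents (Sub A₀)
  Antecedents = concatMap antecedents (Sub A₀) ++ Labels ++ map ◇_ Labels
  Boxed = map ¬'_ Antecedents ++ concatMap boxBodies (Sub A₀)
  Φ = Sub A₀ ++ Antecedents ++ Boxed ++ map □_ Boxed

  ▷-antecedent : ∀ {A B} → (A ▷ B) ∈ Sub A₀ → A ∈ Antecedents
  ▷-antecedent m = ∈-++⁺ˡ (∈-concatMap⁺ antecedents (lose m (here refl)))

  ▷-label : ∀ {A B} → (A ▷ B) ∈ Sub A₀ → B ∈ Labels
  ▷-label m = there (∈-concatMap⁺ consequents (lose m (here refl)))

  label-antecedent : ∀ {C} → C ∈ Labels → C ∈ Antecedents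
  label-antecedent m = ∈-++⁺ʳ (concatMap antecedents (Sub A₀)) (∈-++⁺ˡ m)

  ◇label-antecedent : ∀ {C} → C ∈ Labels → (◇ C) ∈ Antecedents
  ◇label-antecedent m = ∈-++⁺ʳ (concatMap antecedents (Sub A₀)) (∈-++⁺ʳ Labels (∈-map⁺ ◇_ m))

  ¬antecedent-boxed : ∀ {E} → E ∈ Antecedents → (¬' E) ∈ Boxed
  ¬antecedent-boxed m = ∈-++⁺ˡ (∈-map⁺ ¬'_ m)

  □-boxed : ∀ {X} → (□ X) ∈ Sub A₀ → X ∈ Boxed
  □-boxed m = ∈-++⁺ʳ (map ¬'_ Antecedents) (∈-concatMap⁺ boxBodies (lose m (here refl)))

  sub-Φ : ∀ {X} → X ∈ Sub A₀ → X ∈ Φ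
  sub-Φ = ∈-++⁺ˡ

  antecedent-Φ : ∀ {X} → X ∈ Antecedents → X ∈ Φ
  antecedent-Φ m = ∈-++⁺ʳ (Sub A₀) (∈-++⁺ˡ m)

  boxed-Φ : ∀ {X} → X ∈ Boxed → X ∈ Φ
  boxed-Φ m = ∈-++⁺ʳ (Sub A₀) (∈-++⁺ʳ Antecedents (∈-++⁺ˡ m))

  □boxed-Φ : ∀ {X} → X ∈ Boxed → (□ X) ∈ Φ
  □boxed-Φ m = ∈-++⁺ʳ (Sub A₀) (∈-++⁺ʳ Antecedents (∈-++⁺ʳ Boxed (∈-map⁺ □_ m)))

  Context : Set
  Context = Vec Bool (length Φ)

  ctx : Context → Fm
  ctx = signed Φ

  infix 4 _≺_ _≺[_]_
  _≺_ : Fm → Fm → Set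
  c ≺ d = (∀ X → X ∈ Boxed → c ⊩ □ X → (d ⊩ X) × (d ⊩ □ X)) ×
          Σ Fm (λ X → X ∈ Boxed × (d ⊩ □ X) × ¬ (c ⊩ □ X))

  _≺[_]_ : Fm → Fm → Fm → Set
  c ≺[ C ] d = c ≺ d × (∀ E → E ∈ Antecedents → c ⊩ E ▷ C → (d ⊩ ¬' E) × (d ⊩ □ (¬' E)))

  ≺-trans : ∀ {a c d} → a ≺ c → c ≺ d → a ≺ d
  ≺-trans (a⇒c , _) (c⇒d , X , X∈ , d⊩□X , c⊮□X) =
    (λ Z Z∈ a⊩□Z → c⇒d Z Z∈ (proj₂ (a⇒c Z Z∈ a⊩□Z))) ,
    X , X∈ , d⊩□X , (λ a⊩□X → c⊮□X (proj₂ (a⇒c X X∈ a⊩□X)))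

  ≺[]-≺ : ∀ {C a c d} → a ≺[ C ] c → c ≺ d → a ≺[ C ] d
  ≺[]-≺ (a≺c , crit) c≺d@(c⇒d , _) =
    ≺-trans a≺c c≺d , (λ E E∈ a⊩E▷C → c⇒d (¬' E) (¬antecedent-boxed E∈) (proj₂ (crit E E∈ a⊩E▷C)))

  boxCount : Fm → ℕ
  boxCount c = length (filter (λ X → em {c ⊩ □ X}) Boxed)

  ≺-boxCount : ∀ {c d} → c ≺ d → boxCount c < boxCount d
  ≺-boxCount {c} {d} (c⇒d , X , X∈ , d⊩□X , c⊮□X) =
    filter-strict (λ X → em {c ⊩ □ X}) (λ X → em {d ⊩ □ X}) Boxed
                  (λ {Y} Y∈ c⊩□Y → proj₂ (c⇒d Y Y∈ c⊩□Y)) X∈ d⊩□X c⊮□X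

  boxObligations : Fm → List Fm
  boxObligations c = selected (λ X → em {c ⊩ □ X}) (λ X → X ∷ □ X ∷ []) Boxed

  criticalObligations : Fm → Fm → List Fm
  criticalObligations c C = selected (λ E → em {c ⊩ E ▷ C}) (λ E → (¬' E) ∷ □ (¬' E) ∷ []) Antecedents

  obligations : Fm → Fm → List Fm
  obligations c C = boxObligations c ++ criticalObligations c C

  obligation-▷ : ∀ c C u → u ∈ obligations c C → c ⊩ (¬' u) ▷ C
  obligation-▷ c C u u∈ with ∈-++⁻ (boxObligations c) u∈
  ... | inj₁ u∈box with ∈-selected⁻ (λ X → em {c ⊩ □ X}) (λ X → X ∷ □ X ∷ []) {Boxed} u∈box
  ...   | X , _ , c⊩□X , here refl = ⊩-□▷ c⊩□X
  ...   | X , _ , c⊩□X , there (here refl) = ⊩-R2 ¬□X⇒◇¬X (⊩-J5 (⊩-□▷ c⊩□X))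
    where
      ¬□X⇒◇¬X : ⊢ₗ (¬' □ X) ⇒ ◇ (¬' X)
      ¬□X⇒◇¬X = contraposition (□-mono (by-table (¬ₜ ¬ₜ #0 ⇒ₜ #0) (X ∷ []) refl))
  obligation-▷ c C u u∈ | inj₂ u∈crit
    with ∈-selected⁻ (λ E → em {c ⊩ E ▷ C}) (λ E → (¬' E) ∷ □ (¬' E) ∷ []) {Antecedents} u∈crit
  ... | E , _ , c⊩E▷C , here refl = ⊩-R2 (by-table (¬ₜ ¬ₜ #0 ⇒ₜ #0) (E ∷ []) refl) c⊩E▷C
  ... | E , _ , c⊩E▷C , there (here refl) = ⊩-J5 c⊩E▷C

  obligation-literal : ∀ c C u → u ∈ obligations c C → Literal Φ u
  obligation-literal c C u u∈ with ∈-++⁻ (boxObligations c) u∈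
  ... | inj₁ u∈box with ∈-selected⁻ (λ X → em {c ⊩ □ X}) (λ X → X ∷ □ X ∷ []) {Boxed} u∈box
  ...   | X , X∈ , _ , here refl = inj₁ (boxed-Φ X∈)
  ...   | X , X∈ , _ , there (here refl) = inj₁ (□boxed-Φ X∈)
  obligation-literal c C u u∈ | inj₂ u∈crit
    with ∈-selected⁻ (λ E → em {c ⊩ E ▷ C}) (λ E → (¬' E) ∷ □ (¬' E) ∷ []) {Antecedents} u∈crit
  ... | E , E∈ , _ , here refl = inj₂ (E , refl , antecedent-Φ E∈)
  ... | E , E∈ , _ , there (here refl) = inj₁ (□boxed-Φ (¬antecedent-boxed E∈))

  record CriticalSuccessor (c C : Fm) (T : List Fm) : Set where
    field
      context : Context
      consistent : Consistent (ctx context)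
      proves : ∀ u → u ∈ T → ctx context ⊩ u
      critical : c ≺[ C ] ctx context

  critical-successor : ∀ c C T W → Consistent (conj T) → (∀ u → u ∈ T → Literal Φ u) →
                       (∀ u → u ∈ obligations c C → u ∈ T) →
                       (□ W) ∈ T → W ∈ Boxed → ¬ (c ⊩ □ W) → CriticalSuccessor c C T
  critical-successor c C T W consT literalT obligT □W∈T W∈ c⊮□W = record
    { context = b
    ; consistent = consistent-⇒ ∧-elimˡ cb
    ; proves = proves
    ; critical = (inherits , W , W∈ , proves (□ W) □W∈T , c⊮□W) , avoids
    }
    where
      b : Context
      b = proj₁ (lindenbaum Φ (conj T) consT)
      cb : Consistent (ctx b ⋀ conj T)
      cb = proj₂ (lindenbaum Φ (conj T) consT)
      proves : ∀ u → u ∈ T → ctx b ⊩ u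
      proves u u∈T = signed-proves Φ b T cb u∈T (literalT u u∈T)
      box-oblig : ∀ {X u} → X ∈ Boxed → c ⊩ □ X → u ∈ X ∷ □ X ∷ [] → ctx b ⊩ u
      box-oblig X∈ c⊩□X u∈ = proves _ (obligT _ (∈-++⁺ˡ
        (∈-selected⁺ (λ X → em {c ⊩ □ X}) (λ X → X ∷ □ X ∷ []) X∈ c⊩□X u∈)))
      crit-oblig : ∀ {E u} → E ∈ Antecedents → c ⊩ E ▷ C → u ∈ (¬' E) ∷ □ (¬' E) ∷ [] → ctx b ⊩ u
      crit-oblig E∈ c⊩E▷C u∈ = proves _ (obligT _ (∈-++⁺ʳ (boxObligations c)
        (∈-selected⁺ (λ E → em {c ⊩ E ▷ C}) (λ E → (¬' E) ∷ □ (¬' E) ∷ []) E∈ c⊩E▷C u∈)))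
      inherits : ∀ X → X ∈ Boxed → c ⊩ □ X → (ctx b ⊩ X) × (ctx b ⊩ □ X)
      inherits X X∈ c⊩□X = box-oblig X∈ c⊩□X (here refl) , box-oblig X∈ c⊩□X (there (here refl))
      avoids : ∀ E → E ∈ Antecedents → c ⊩ E ▷ C → (ctx b ⊩ ¬' E) × (ctx b ⊩ □ (¬' E))
      avoids E E∈ c⊩E▷C = crit-oblig E∈ c⊩E▷C (here refl) , crit-oblig E∈ c⊩E▷C (there (here refl))

  -- Worlds: nonempty sequences of labelled contexts, of length below K,
  -- stored as a length together with a vector of K entries.
  Entry : Set
  Entry = Fin (length Labels) × Context

  label : Entry → Fm
  label e = lookup Labels (proj₁ e)

  ctxOf : Entry → Fm
  ctxOf e = ctx (proj₂ e)

  blank : Entry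
  blank = fzero , replicate _ false

  -- well-formed worlds have length at most 1 + length Boxed (length-bound),
  -- so K leaves room to append one more entry
  K : ℕ
  K = suc (suc (length Boxed))

  World : Set
  World = Fin (suc K) × Vec Entry K

  len : World → ℕ
  len w = toℕ (proj₁ w)

  entry : World → ℕ → Entry
  entry w = at blank (proj₂ w)

  end : World → Fm
  end w = ctxOf (entry w (pred (len w)))

  Step : World → ℕ → Set
  Step w j = ctxOf (entry w (pred j)) ≺[ label (entry w j) ] ctxOf (entry w j)

  record WellFormed (w : World) : Set where
    field
      nonempty : 0 < len w
      consistent : ∀ i → i < len w → Consistent (ctxOf (entry w i))
      steps : ∀ j → 0 < j → j < len w → Step w j
  open WellFormed

  pred< : ∀ {n} → 0 < n → pred n < n
  pred< {suc n} _ = ≤-refl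

  end-consistent : ∀ {w} → WellFormed w → Consistent (end w)
  end-consistent wf = consistent wf _ (pred< (nonempty wf))

  critical-from : ∀ {w} → WellFormed w → ∀ i j → 0 < i → i ≤ j → j < len w →
                  ctxOf (entry w (pred i)) ≺[ label (entry w i) ] ctxOf (entry w j)
  critical-from wf (suc i) zero _ () _
  critical-from wf i (suc j) 0<i i≤j+1 j+1<len with m≤n⇒m<n∨m≡n i≤j+1
  ... | inj₂ refl = steps wf i 0<i j+1<len
  ... | inj₁ (s≤s i≤j) = ≺[]-≺ (critical-from wf i j 0<i i≤j (<-trans (n<1+n j) j+1<len))
                               (proj₁ (steps wf (suc j) (s≤s z≤n) j+1<len))

  position-boxCount : ∀ {w} → WellFormed w → ∀ j → j < len w → j ≤ boxCount (ctxOf (entry w j))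
  position-boxCount wf zero _ = z≤n
  position-boxCount wf (suc j) j+1<len =
    <-≤-trans (s≤s (position-boxCount wf j (<-trans (n<1+n j) j+1<len)))
              (≺-boxCount (proj₁ (steps wf (suc j) (s≤s z≤n) j+1<len)))

  length-bound : ∀ {w} → WellFormed w → len w < K
  length-bound {w} wf with len w | nonempty wf | position-boxCount wf (pred (len w))
  ... | suc n | _ | bound = s≤s (s≤s (≤-trans (bound ≤-refl) (length-filter _ Boxed)))

  infix 4 _⊏_
  record _⊏_ (σ τ : World) : Set where
    field
      source : WellFormed σ
      target : WellFormed τ
      longer : len σ < len τ
      prefix : ∀ i → i < len σ → entry σ i ≡ entry τ i
  open _⊏_

  ⊏-trans : ∀ {σ τ ρ} → σ ⊏ τ → τ ⊏ ρ → σ ⊏ ρ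
  ⊏-trans σ⊏τ τ⊏ρ = record
    { source = source σ⊏τ ; target = target τ⊏ρ
    ; longer = <-trans (longer σ⊏τ) (longer τ⊏ρ)
    ; prefix = λ i i< → trans (prefix σ⊏τ i i<) (prefix τ⊏ρ i (<-trans i< (longer σ⊏τ)))
    }

  newLabel : World → World → Fin (length Labels)
  newLabel σ τ = proj₁ (entry τ (len σ))

  ⊏-critical : ∀ {σ τ} → σ ⊏ τ → end σ ≺[ lookup Labels (newLabel σ τ) ] end τ
  ⊏-critical {σ} {τ} σ⊏τ =
    subst (λ e → ctxOf e ≺[ lookup Labels (newLabel σ τ) ] end τ)
          (sym (prefix σ⊏τ _ (pred< (nonempty (source σ⊏τ)))))
          (critical-from (target σ⊏τ) (len σ) (pred (len τ)) (nonempty (source σ⊏τ))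
                         (<⇒≤pred (longer σ⊏τ)) (pred< (nonempty (target σ⊏τ))))

  Sel : World → World → World → Set
  Sel σ τ ρ = σ ⊏ τ × σ ⊏ ρ × newLabel σ τ ≡ newLabel σ ρ × (end ρ ⊩ ¬' lookup Labels (newLabel σ τ))

  extend : (w : World) → len w < K → Entry → World
  extend (n , v) h e = fromℕ< (s≤s h) , setAt v (toℕ n) e

  len-extend : ∀ w h e → len (extend w h e) ≡ suc (len w)
  len-extend (n , v) h e = toℕ-fromℕ< (s≤s h)

  entry-extend-< : ∀ w h e i → i < len w → entry (extend w h e) i ≡ entry w i
  entry-extend-< (n , v) h e i i< = at-setAt-< blank v (toℕ n) i e i<

  entry-extend-≡ : ∀ w h e → entry (extend w h e) (len w) ≡ e
  entry-extend-≡ (n , v) h e = at-setAt-≡ blank v (toℕ n) e h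

  end-extend : ∀ w h e → end (extend w h e) ≡ ctxOf e
  end-extend w h e = trans (cong (λ k → ctxOf (entry (extend w h e) (pred k))) (len-extend w h e))
                           (cong ctxOf (entry-extend-≡ w h e))

  extend-⊏ : ∀ w h e → WellFormed w → Consistent (ctxOf e) → end w ≺[ label e ] ctxOf e → w ⊏ extend w h e
  extend-⊏ w h e wf cons-e crit-e = record
    { source = wf ; target = wf′ ; longer = subst (len w <_) (sym (len-extend w h e)) ≤-refl
    ; prefix = λ i i< → sym (entry-extend-< w h e i i<) }
    where
      w′ = extend w h e
      old : ∀ {i} → i < len w → entry w′ i ≡ entry w i
      old = entry-extend-< w h e _
      position : ∀ {i} → i < len w′ → i < len w ⊎ i ≡ len w
      position {i} i< = m<1+n⇒m<n∨m≡n (subst (i <_) (len-extend w h e) i<)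
      consistent′ : ∀ i → i < len w′ → Consistent (ctxOf (entry w′ i))
      consistent′ i i< with position i<
      ... | inj₁ i<len = subst (λ x → Consistent (ctxOf x)) (sym (old i<len)) (consistent wf i i<len)
      ... | inj₂ refl = subst (λ x → Consistent (ctxOf x)) (sym (entry-extend-≡ w h e)) cons-e
      step-cong : ∀ {d d′ e e′} → d ≡ d′ → e ≡ e′ →
                  ctxOf d ≺[ label e ] ctxOf e → ctxOf d′ ≺[ label e′ ] ctxOf e′
      step-cong = subst₂ (λ a b → ctxOf a ≺[ label b ] ctxOf b)
      steps′ : ∀ j → 0 < j → j < len w′ → Step w′ j
      steps′ j 0<j j< with position j<
      ... | inj₁ j<len =
        step-cong (sym (old (≤-<-trans pred[n]≤n j<len))) (sym (old j<len)) (steps wf j 0<j j<len)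
      ... | inj₂ refl = step-cong (sym (old (pred< (nonempty wf)))) (sym (entry-extend-≡ w h e)) crit-e
      wf′ : WellFormed w′
      wf′ = record { nonempty = subst (0 <_) (sym (len-extend w h e)) (s≤s z≤n)
                   ; consistent = consistent′ ; steps = steps′ }

  ⊏-room : ∀ {σ τ} → σ ⊏ τ → K ∸ len τ < K ∸ len σ
  ⊏-room {τ = τ} σ⊏τ = ∸-monoʳ-< (longer σ⊏τ) (≤-pred (toℕ<n (proj₁ τ)))

  frame : Frame
  frame = record
    { W = World
    ; inhabited = fzero , replicate K blank
    ; R = _⊏_
    ; S = Sel
    ; R-trans = ⊏-trans
    ; R-cwf = Subrelation.wellFounded ⊏-room (On.wellFounded (λ w → K ∸ len w) <-wellFounded)
    ; S⊆R = proj₁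
    }

  -- J5: if σ ⊏ τ ⊏ ρ then ρ refutes the new label C of τ, since τ refutes
  -- the antecedent ◇C of σ ⊩ ◇C ▷ C, i.e. proves □¬C, and ρ inherits ¬C.
  J5-frame : J5Condition frame
  J5-frame {σ} {τ} {ρ} σ⊏τ τ⊏ρ =
    σ⊏τ , ⊏-trans σ⊏τ τ⊏ρ , cong proj₁ (prefix τ⊏ρ (len σ) (longer σ⊏τ)) , ρ⊩¬C
    where
      C = lookup Labels (newLabel σ τ)
      C∈ : C ∈ Labels
      C∈ = ∈-lookup (newLabel σ τ)
      τ⊩¬◇C : end τ ⊩ ¬' (◇ C)
      τ⊩¬◇C = proj₁ (proj₂ (⊏-critical σ⊏τ) (◇ C) (◇label-antecedent C∈) (⊩-thm (J5-derivable L C)))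
      τ⊩□¬C : end τ ⊩ □ (¬' C)
      τ⊩□¬C = ⊩-⇒ (by-table (¬ₜ ¬ₜ #0 ⇒ₜ #0) (□ (¬' C) ∷ []) refl) τ⊩¬◇C
      ρ⊩¬C : end ρ ⊩ ¬' C
      ρ⊩¬C = proj₁ (proj₁ (proj₁ (⊏-critical τ⊏ρ)) (¬' C) (¬antecedent-boxed (label-antecedent C∈)) τ⊩□¬C)

  J2-frame : J2Condition frame
  J2-frame = (λ s → proj₁ (proj₂ s)) , transitive
    where
      transitive : ∀ {σ τ υ ρ} → Sel σ τ υ → Sel σ υ ρ → Sel σ τ ρ
      transitive {σ} {ρ = ρ} (σ⊏τ , _ , τ~υ , _) (_ , σ⊏ρ , υ~ρ , ρ⊩¬C) =
        σ⊏τ , σ⊏ρ , trans τ~υ υ~ρ , subst (λ i → end ρ ⊩ ¬' lookup Labels i) (sym τ~υ) ρ⊩¬C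

  J1-frame : (∀ C → ⊢ₗ C ▷ C) → J1Condition frame
  J1-frame C▷C {σ} {τ} σ⊏τ =
    σ⊏τ , σ⊏τ , refl ,
    proj₁ (proj₂ (⊏-critical σ⊏τ) _ (label-antecedent (∈-lookup (newLabel σ τ))) (⊩-thm (C▷C _)))

  successor-world : ∀ w → WellFormed w → ∀ i {T} → CriticalSuccessor (end w) (lookup Labels i) T →
                    Σ World (λ τ → w ⊏ τ × newLabel w τ ≡ i × (∀ u → u ∈ T → end τ ⊩ u))
  successor-world w wf i s =
    extend w h e , extend-⊏ w h e wf (CriticalSuccessor.consistent s) (CriticalSuccessor.critical s) ,
    cong proj₁ (entry-extend-≡ w h e) ,
    (λ u u∈ → subst (_⊩ u) (sym (end-extend w h e)) (CriticalSuccessor.proves s u u∈))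
    where
      h : len w < K
      h = length-bound wf
      e : Entry
      e = i , CriticalSuccessor.context s

  refuting-world : ∀ w → WellFormed w → ∀ A i W → Literal Φ A → W ∈ Boxed → ⊢ₗ □ (¬' A) ⇒ □ W →
                   ¬ (end w ⊩ A ▷ lookup Labels i) → ¬ (end w ⊩ □ W) →
                   Σ World (λ τ → w ⊏ τ × newLabel w τ ≡ i × (end τ ⊩ A))
  refuting-world w wf A i W A-literal W∈ □¬A⇒□W w⊮A▷C w⊮□W =
    let τ , w⊏τ , new , proves = successor-world w wf i succ in τ , w⊏τ , new , proves A (here refl)
    where
      C = lookup Labels i
      P = obligations (end w) C
      literal : ∀ u → u ∈ A ∷ □ W ∷ P → Literal Φ u
      literal u (here refl) = A-literal
      literal u (there (here refl)) = inj₁ (□boxed-Φ W∈)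
      literal u (there (there u∈P)) = obligation-literal (end w) C u u∈P
      succ : CriticalSuccessor (end w) C (A ∷ □ W ∷ P)
      succ = critical-successor (end w) C _ W (refuting-successor P (obligation-▷ (end w) C) □¬A⇒□W w⊮A▷C)
                                literal (λ u → there ∘ there) (there (here refl)) W∈ w⊮□W

  answering-world : ∀ w → WellFormed w → ∀ A B i → B ∈ Labels → end w ⊩ A ▷ B →
                    ¬ (end w ⊩ A ▷ lookup Labels i) →
                    Σ World (λ τ → w ⊏ τ × newLabel w τ ≡ i × (end τ ⊩ B) × (end τ ⊩ ¬' lookup Labels i))
  answering-world w wf A B i B∈ w⊩A▷B w⊮A▷C =
    let τ , w⊏τ , new , proves = successor-world w wf i succ
    in τ , w⊏τ , new , proves B (here refl) , proves (¬' C) (there (there (here refl)))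
    where
      C = lookup Labels i
      P = obligations (end w) C
      literal : ∀ u → u ∈ B ∷ □ (¬' B) ∷ (¬' C) ∷ P → Literal Φ u
      literal u (here refl) = inj₁ (antecedent-Φ (label-antecedent B∈))
      literal u (there (here refl)) = inj₁ (□boxed-Φ (¬antecedent-boxed (label-antecedent B∈)))
      literal u (there (there (here refl))) = inj₂ (C , refl , antecedent-Φ (label-antecedent (∈-lookup i)))
      literal u (there (there (there u∈P))) = obligation-literal (end w) C u u∈P
      -- □¬B is new: otherwise A ▷ B ▷ C
      w⊮□¬B : ¬ (end w ⊩ □ (¬' B))
      w⊮□¬B w⊩□¬B = w⊮A▷C (⊩-J2 w⊩A▷B (⊩-□¬▷ w⊩□¬B))
      succ : CriticalSuccessor (end w) C (B ∷ □ (¬' B) ∷ (¬' C) ∷ P)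
      succ = critical-successor (end w) C _ (¬' B) (answering-successor P (obligation-▷ (end w) C) w⊩A▷B w⊮A▷C)
                                literal (λ u → there ∘ there ∘ there) (there (here refl))
                                (¬antecedent-boxed (label-antecedent B∈)) w⊮□¬B

  valuation : Valuation frame
  valuation w p = end w ⊩ var p

  infix 2 _⊨_
  _⊨_ : World → Fm → Set
  w ⊨ X = Forces frame valuation w X

  end-decides : ∀ w {X} → X ∈ Sub A₀ → (end w ⊩ X) ⊎ (end w ⊩ ¬' X)
  end-decides w X∈ = signed-decides Φ (proj₂ (entry w (pred (len w)))) (sub-Φ X∈)

  Truth : Fm → World → Set
  Truth X w = (w ⊨ X → end w ⊩ X) × (end w ⊩ X → w ⊨ X)

  -- □A is forced only if proved: otherwise, as w ⊮ ¬A ▷ ⊥ by J6, an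
  -- extension with label ⊥ (index 0) proves ¬A
  □-truth : ∀ {A} → Sub (□ A) ⊆ Sub A₀ → (∀ τ → WellFormed τ → Truth A τ) →
            ∀ w → WellFormed w → Truth (□ A) w
  □-truth {A} sub truthA w wf = forward , backward
    where
      □A∈ : (□ A) ∈ Sub A₀
      □A∈ = sub (here refl)
      A∈ : A ∈ Sub A₀
      A∈ = sub (there (here refl))
      forward : w ⊨ □ A → end w ⊩ □ A
      forward w⊨□A with em {end w ⊩ □ A}
      ... | yes w⊩□A = w⊩□A
      ... | no w⊮□A =
        ⊥-elim (unrefuted (refuting-world w wf (¬' A) fzero A (inj₂ (A , refl , sub-Φ A∈)) (□-boxed □A∈)
                                          (□-mono (by-table (¬ₜ ¬ₜ #0 ⇒ₜ #0) (A ∷ []) refl))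
                                          (λ w⊩¬A▷⊥ → w⊮□A (⊩-⇒ (▷⊥⇒□ A) w⊩¬A▷⊥)) w⊮□A))
        where
          unrefuted : Σ World (λ τ → w ⊏ τ × newLabel w τ ≡ fzero × (end τ ⊩ ¬' A)) → ⊥
          unrefuted (τ , w⊏τ , _ , τ⊩¬A) =
            inconsistent (end-consistent (target w⊏τ)) (proj₁ (truthA τ (target w⊏τ)) (w⊨□A τ w⊏τ)) τ⊩¬A
      backward : end w ⊩ □ A → w ⊨ □ A
      backward w⊩□A τ w⊏τ =
        proj₂ (truthA τ (target w⊏τ)) (proj₁ (proj₁ (proj₁ (⊏-critical w⊏τ)) A (□-boxed □A∈) w⊩□A))

  -- A ▷ B is forced only if proved: otherwise an extension τ labelled B
  -- proves A, and every S_w-successor of τ refutes B.  Conversely a proved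
  -- A ▷ B is answered, by the existence lemma, inside the label of τ.
  ▷-truth : ∀ {A B} → Sub (A ▷ B) ⊆ Sub A₀ →
            (∀ τ → WellFormed τ → Truth A τ) → (∀ τ → WellFormed τ → Truth B τ) →
            ∀ w → WellFormed w → Truth (A ▷ B) w
  ▷-truth {A} {B} sub truthA truthB w wf = forward , backward
    where
      A▷B∈ : (A ▷ B) ∈ Sub A₀
      A▷B∈ = sub (here refl)
      B∈ : B ∈ Labels
      B∈ = ▷-label A▷B∈
      iB : Fin (length Labels)
      iB = Any.index B∈
      B≡ : B ≡ lookup Labels iB
      B≡ = lookup-index B∈
      forward : w ⊨ A ▷ B → end w ⊩ A ▷ B
      forward w⊨A▷B with em {end w ⊩ A ▷ B}
      ... | yes w⊩A▷B = w⊩A▷B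
      ... | no w⊮A▷B =
        ⊥-elim (unanswered (refuting-world w wf A iB (¬' A) (inj₁ (antecedent-Φ (▷-antecedent A▷B∈)))
                                           (¬antecedent-boxed (▷-antecedent A▷B∈)) ⇒-refl
                                           (λ w⊩A▷C → w⊮A▷B (subst (λ C → end w ⊩ A ▷ C) (sym B≡) w⊩A▷C))
                                           (λ w⊩□¬A → w⊮A▷B (⊩-□¬▷ w⊩□¬A))))
        where
          unanswered : Σ World (λ τ → w ⊏ τ × newLabel w τ ≡ iB × (end τ ⊩ A)) → ⊥
          unanswered (τ , w⊏τ , new , τ⊩A) = refutes (w⊨A▷B τ w⊏τ (proj₂ (truthA τ (target w⊏τ)) τ⊩A))
            where
              refutes : Σ World (λ ρ → Sel w τ ρ × (ρ ⊨ B)) → ⊥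
              refutes (ρ , (_ , w⊏ρ , _ , ρ⊩¬C) , ρ⊨B) =
                inconsistent (end-consistent (target w⊏ρ)) (proj₁ (truthB ρ (target w⊏ρ)) ρ⊨B)
                             (subst (λ C → end ρ ⊩ ¬' C) (trans (cong (lookup Labels) new) (sym B≡)) ρ⊩¬C)
      backward : end w ⊩ A ▷ B → w ⊨ A ▷ B
      backward w⊩A▷B τ w⊏τ τ⊨A =
        let ρ , w⊏ρ , new , ρ⊩B , ρ⊩¬C = answering-world w wf A B (newLabel w τ) B∈ w⊩A▷B w⊮A▷C
        in ρ , (w⊏τ , w⊏ρ , sym new , ρ⊩¬C) , proj₂ (truthB ρ (target w⊏ρ)) ρ⊩B
        where
          -- τ is critical for its label C over w and proves A, so w ⊮ A ▷ C
          w⊮A▷C : ¬ (end w ⊩ A ▷ lookup Labels (newLabel w τ))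
          w⊮A▷C w⊩A▷C = inconsistent (end-consistent (target w⊏τ)) (proj₁ (truthA τ (target w⊏τ)) τ⊨A)
                                      (proj₁ (proj₂ (⊏-critical w⊏τ) A (▷-antecedent A▷B∈) w⊩A▷C))

  truth : ∀ X → Sub X ⊆ Sub A₀ → ∀ w → WellFormed w → Truth X w
  truth (var p) sub w wf = id , id
  truth ⊤' sub w wf = (λ _ → ⊩-thm (by-table ⊤ₜ [] refl)) , (λ _ → tt)
  truth ⊥' sub w wf = (λ ()) , end-consistent wf
  truth (¬' A) sub w wf = forward , backward
    where
      IH : Truth A w
      IH = truth A (λ m → sub (there m)) w wf
      forward : w ⊨ ¬' A → end w ⊩ ¬' A
      forward w⊭A with end-decides w (sub (there (here refl)))
      ... | inj₁ w⊩A = ⊥-elim (w⊭A (proj₂ IH w⊩A))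
      ... | inj₂ w⊩¬A = w⊩¬A
      backward : end w ⊩ ¬' A → w ⊨ ¬' A
      backward w⊩¬A w⊨A = inconsistent (end-consistent wf) (proj₁ IH w⊨A) w⊩¬A
  truth (A ⋀ B) sub w wf =
    (λ (a , b) → ⊩-∧ (proj₁ IHA a) (proj₁ IHB b)) ,
    (λ w⊩A∧B → proj₂ IHA (⊩-⇒ ∧-elimˡ w⊩A∧B) , proj₂ IHB (⊩-⇒ ∧-elimʳ w⊩A∧B))
    where
      IHA : Truth A w
      IHA = truth A (λ m → sub (there (∈-++⁺ˡ m))) w wf
      IHB : Truth B w
      IHB = truth B (λ m → sub (there (∈-++⁺ʳ (Sub A) m))) w wf
  truth (A ⋁ B) sub w wf = forward , backward
    where
      IHA : Truth A w
      IHA = truth A (λ m → sub (there (∈-++⁺ˡ m))) w wf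
      IHB : Truth B w
      IHB = truth B (λ m → sub (there (∈-++⁺ʳ (Sub A) m))) w wf
      forward : w ⊨ A ⋁ B → end w ⊩ A ⋁ B
      forward (inj₁ a) = ⊩-⇒ (by-table (#0 ⇒ₜ #0 ∨ₜ #1) (A ∷ B ∷ []) refl) (proj₁ IHA a)
      forward (inj₂ b) = ⊩-⇒ (by-table (#1 ⇒ₜ #0 ∨ₜ #1) (A ∷ B ∷ []) refl) (proj₁ IHB b)
      backward : end w ⊩ A ⋁ B → w ⊨ A ⋁ B
      backward w⊩A∨B with end-decides w (sub (there (here refl)))
      ... | inj₁ w⊩A = inj₁ (proj₂ IHA w⊩A)
      ... | inj₂ w⊩¬A =
        inj₂ (proj₂ IHB (⊩-mp (⊩-⇒ (by-table (#0 ∨ₜ #1 ⇒ₜ ¬ₜ #0 ⇒ₜ #1) (A ∷ B ∷ []) refl) w⊩A∨B) w⊩¬A))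
  truth (A ⇒ B) sub w wf = forward , backward
    where
      IHA : Truth A w
      IHA = truth A (λ m → sub (there (∈-++⁺ˡ m))) w wf
      IHB : Truth B w
      IHB = truth B (λ m → sub (there (∈-++⁺ʳ (Sub A) m))) w wf
      forward : w ⊨ A ⇒ B → end w ⊩ A ⇒ B
      forward w⊨A⇒B with end-decides w (sub (there (here refl)))
      ... | inj₁ w⊩A = ⊩-⇒ (by-table (#1 ⇒ₜ #0 ⇒ₜ #1) (A ∷ B ∷ []) refl) (proj₁ IHB (w⊨A⇒B (proj₂ IHA w⊩A)))
      ... | inj₂ w⊩¬A = ⊩-⇒ (by-table (¬ₜ #0 ⇒ₜ #0 ⇒ₜ #1) (A ∷ B ∷ []) refl) w⊩¬A
      backward : end w ⊩ A ⇒ B → w ⊨ A ⇒ B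
      backward w⊩A⇒B w⊨A = proj₂ IHB (⊩-mp w⊩A⇒B (proj₁ IHA w⊨A))
  truth (□ A) sub = □-truth sub (truth A (λ m → sub (there m)))
  truth (A ▷ B) sub = ▷-truth sub (truth A (λ m → sub (there (∈-++⁺ˡ m))))
                                  (truth B (λ m → sub (there (∈-++⁺ʳ (Sub A) m))))

  -- If L ⊬ A₀, the one-entry world whose context extends ¬A₀ refutes A₀.
  countermodel : ¬ (⊢ₗ A₀) → Σ World (λ w → WellFormed w × ¬ (w ⊨ A₀))
  countermodel ⊬A₀ = w₀ , wf₀ , (λ w₀⊨A₀ → refutes (proj₁ (truth A₀ id w₀ wf₀) w₀⊨A₀))
    where
      ¬A₀-consistent : Consistent (¬' A₀)
      ¬A₀-consistent h = ⊬A₀ (by-table ((¬ₜ #0 ⇒ₜ ⊥ₜ) ⇒ₜ #0) (A₀ ∷ []) refl · h)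
      b₀ : Context
      b₀ = proj₁ (lindenbaum Φ (¬' A₀) ¬A₀-consistent)
      cb₀ : Consistent (ctx b₀ ⋀ (¬' A₀))
      cb₀ = proj₂ (lindenbaum Φ (¬' A₀) ¬A₀-consistent)
      w₀ : World
      w₀ = fromℕ< {1} (s≤s (s≤s z≤n)) , ((fzero , b₀) ∷ replicate _ blank)
      consistent₀ : ∀ i → i < 1 → Consistent (ctxOf (entry w₀ i))
      consistent₀ zero _ = consistent-⇒ ∧-elimˡ cb₀
      consistent₀ (suc i) (s≤s ())
      wf₀ : WellFormed w₀
      wf₀ = record { nonempty = s≤s z≤n ; consistent = consistent₀ ; steps = λ { (suc j) _ (s≤s ()) } }
      refutes : ¬ (ctx b₀ ⊩ A₀)
      refutes p = cb₀ (by-table ((#0 ⇒ₜ #1) ⇒ₜ (#0 ∧ₜ ¬ₜ #1 ⇒ₜ ⊥ₜ)) (ctx b₀ ∷ A₀ ∷ []) refl · p)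

canonical-finite : ∀ L (em : ExcludedMiddle 0ℓ) A₀ → FiniteFrame (Canonical.frame L em A₀)
canonical-finite L em A₀ = _ , ↔-trans (↔-refl ×-↔ vec↔ entry↔ K) (↔-sym *↔×)
  where
    open Canonical L em A₀
    entry↔ : Entry ↔ Fin (length Labels * 2 ^ length Φ)
    entry↔ = ↔-trans (↔-refl ×-↔ vec↔ (↔-sym 2↔Bool) _) (↔-sym *↔×)

canonical-LFrame : ∀ L (em : ExcludedMiddle 0ℓ) A₀ → LFrame L (Canonical.frame L em A₀)
canonical-LFrame L em A₀ A (inj₁ ax) = Soundness.base-valid em _ ax
canonical-LFrame IL⁻J2+J5 em A₀ A (inj₂ (inj₁ j2+)) = Soundness.J2+-valid em _ J2-frame j2+
  where open Canonical IL⁻J2+J5 em A₀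
canonical-LFrame IL⁻J2+J5 em A₀ A (inj₂ (inj₂ j5)) = Soundness.J5-valid em _ J5-frame j5
  where open Canonical IL⁻J2+J5 em A₀
canonical-LFrame IL em A₀ A (inj₂ (inj₁ j1)) = Soundness.J1-valid em _ (J1-frame IL-▷-refl) j1
  where open Canonical IL em A₀
canonical-LFrame IL em A₀ A (inj₂ (inj₂ (inj₁ j2))) = Soundness.J2-valid em _ J2-frame j2
  where open Canonical IL em A₀
canonical-LFrame IL em A₀ A (inj₂ (inj₂ (inj₂ j5))) = Soundness.J5-valid em _ J5-frame j5
  where open Canonical IL em A₀

completeness : ExcludedMiddle 0ℓ → ∀ L A → ValidFinL L A → ExtraAx L ⊢ A
completeness em L A valid with em {ExtraAx L ⊢ A}
... | yes ⊢A = ⊢A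
... | no ⊬A = refuted (countermodel ⊬A)
  where
    open Canonical L em A
    refuted : Σ World (λ w → WellFormed w × ¬ (w ⊨ A)) → ExtraAx L ⊢ A
    refuted (w , _ , w⊭A) =
      ⊥-elim (w⊭A (valid frame (canonical-finite L em A) (canonical-LFrame L em A) valuation w))

theorem5p2 : ExcludedMiddle 0ℓ → (L : WhichL) (A : Fm) →
    ((ExtraAx L ⊢ A) ⇔ ValidAllL L A) × (ValidAllL L A ⇔ ValidFinL L A)
theorem5p2 em L A = mk⇔ sound (completeness em L A ∘ finite) , mk⇔ finite (sound ∘ completeness em L A)
  where
    sound : ExtraAx L ⊢ A → ValidAllL L A
    sound ⊢A F LF = Soundness.sound em F L LF ⊢A
    finite : ValidAllL L A → ValidFinL L A
    finite valid F _ = valid F
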